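{- In the game Mines$_3$, player one has a winning strategy: player one can play so that, whatever player two does, at some point the set $X$ of positions marked by player one contains an element of $\triangle_2(B)$.
   Context: $T_n=n(n+1)/2$, $T_0=0$. A finite set $X\subseteq\mathbb{N}$ with $|X|=T_n$, enumerated $x_1<\dots<x_{T_n}$, has $i$-th level $\{x_{T_{i-1}+1},\dots,x_{T_i}\}$ for $1\le i\le n$; $\triangle_n$ is the set of all $X\subseteq\mathbb{N}$ with $|X|=T_n$. For such sets, $X\le Y$ means $X\subseteq Y$ and every level of $X$ is contained in a single level of $Y$, distinct levels of $X$ being contained in distinct levels of $Y$; $\triangle_k(B)=\{Z\in\triangle_k:Z\le B\}$. Mines$_3$ is played on the board $B=\{1,\dots,6\}\in\triangle_3$ by two players who alternate turns, player one moving first; on each turn a player either marks one not-yet-marked position of $B$ with his own mark or passes. The game ends when all positions are marked. With $X$, $Y$ the sets of positions marked by players one and two, player one wins if $X$ contains an element of $\triangle_2(B)$, and player two wins if $Y$ contains an element of $\triangle_2(B)$. -}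

module Defs where

open import Data.Nat using (ℕ; zero; suc; _+_; _*_; _<_)
open import Data.Fin using (Fin; toℕ)
import Data.Fin as Fin
open import Data.List using (List; []; _∷_; take; drop; length)
open import Data.List.Membership.Propositional using (_∈_)
open import Data.List.Relation.Unary.All using (All)
open import Data.List.Relation.Unary.Linked using (Linked)
open import Data.Product using (Σ; ∃; _×_; _,_)
open import Data.Bool using (Bool; true; false; not; if_then_else_)
open import Function.Definitions using (Injective)
open import Relation.Binary.PropositionalEquality using (_≡_)
open import Relation.Nullary using (does)

T : ℕ → ℕ
T zero    = 0
T (suc n) = T n + suc n

-- A finite subset of ℕ is represented by its increasing enumeration
-- x₁ < … < x_m (a strictly increasing list).
-- X ∈ △ n  iff  |X| = T n.
Tri : ℕ → List ℕ → Set
Tri n xs = Linked _<_ xs × length xs ≡ T n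

-- The level i+1 (for i : Fin n, i.e. levels numbered 0..n-1 here) :
-- { x_{T i + 1}, …, x_{T (i+1)} }
level : List ℕ → ℕ → List ℕ
level xs i = drop (T i) (take (T (suc i)) xs)

_⊆_ : List ℕ → List ℕ → Set
X ⊆ Y = All (λ x → x ∈ Y) X

Le : (k n : ℕ) → List ℕ → List ℕ → Set
Le k n X Y =
  X ⊆ Y ×
  Σ (Fin k → Fin n) λ f →
    Injective _≡_ _≡_ f ×
    ((i : Fin k) → level X (toℕ i) ⊆ level Y (toℕ (f i)))

InTriOf : (k n : ℕ) → List ℕ → List ℕ → Set
InTriOf k n Y Z = Tri k Z × Le k n Z Y

B : List ℕ
B = 1 ∷ 2 ∷ 3 ∷ 4 ∷ 5 ∷ 6 ∷ []

-- position i : Fin 6 of the board stands for the number i+1 ∈ B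
pos : Fin 6 → ℕ
pos i = suc (toℕ i)

data Cell : Set where
  empty one two : Cell

Board : Set
Board = Fin 6 → Cell

initial : Board
initial _ = empty

data Move (b : Board) : Set where
  pass : Move b
  mark : (i : Fin 6) → b i ≡ empty → Move b

apply : Cell → (b : Board) → Move b → Board
apply c b pass       = b
apply c b (mark i _) = λ j → if does (i Fin.≟ j) then c else b j

-- A (history-dependent) strategy: given the list of previous
-- configurations (most recent first) and the current one, choose a
-- legal move.
Strategy : Set
Strategy = (past : List Board) → (cur : Board) → Move cur

record GameState : Set where
  constructor state
  field
    oneToMove : Bool
    past      : List Board
    current   : Board

-- Once all positions are
-- marked only `pass` is legal, so the configuration stays fixed (the
-- game has ended).
run : Strategy → Strategy → ℕ → GameState
run σ₁ σ₂ zero = state true [] initial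
run σ₁ σ₂ (suc n) with run σ₁ σ₂ n
... | state true  p c = state false (c ∷ p) (apply one c (σ₁ p c))
... | state false p c = state true  (c ∷ p) (apply two c (σ₂ p c))

OneWins : Board → Set
OneWins b =
  Σ (List ℕ) λ Z →
    InTriOf 2 3 B Z ×
    All (λ z → Σ (Fin 6) λ i → pos i ≡ z × b i ≡ one) Z

-- Player one marks 4 and then a second cell of the top level {4, 5, 6} of B, which player two
-- cannot prevent with a single move.  A cell of {1, 2, 3} together with such a pair is an element
-- of △₂(B), and when player one moves for the third time player two has marked only two cells,
-- so one of 1, 2, 3 is still free.  The game tree of these five half-moves is finite and is
-- checked by running a decision procedure.
module Submission where

open import Defs
open import Data.Bool using (Bool; true; false; if_then_else_)
open import Data.Fin using (Fin; zero; suc; #_; _↑ˡ_; _↑ʳ_; toℕ)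
import Data.Fin as Fin
open import Data.Fin.Properties using (any?; all?)
open import Data.List using (List; []; _∷_; length; filter)
open import Data.List.Relation.Unary.All using (_∷_; []) renaming (all? to allᴸ?)
open import Data.List.Relation.Unary.Linked using (Linked; linked?)
open import Data.Nat using (ℕ; zero; suc; _<_; _≤ᵇ_; _<?_; _≟_)
open import Data.List.Membership.DecPropositional _≟_ using (_∈?_)
open import Data.Product using (Σ; ∃₂; _×_; _,_; map₂)
open import Data.Sum using (inj₁; inj₂; [_,_]′)
open import Data.Empty using (⊥-elim)
open import Function.Definitions using (Injective)
open import Relation.Binary.Definitions using (DecidableEquality)
open import Relation.Binary.PropositionalEquality using (_≡_; _≢_; refl; sym; trans; cong; subst)
open import Relation.Nullary using (Dec; yes; no; does)
open import Relation.Nullary.Decidable using (map′; from-yes; _×-dec_; _⊎-dec_; _→-dec_)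
open import Relation.Unary using (Decidable)

_≟ᶜ_ : DecidableEquality Cell
empty ≟ᶜ empty = yes refl
empty ≟ᶜ one   = no λ ()
empty ≟ᶜ two   = no λ ()
one   ≟ᶜ empty = no λ ()
one   ≟ᶜ one   = yes refl
one   ≟ᶜ two   = no λ ()
two   ≟ᶜ empty = no λ ()
two   ≟ᶜ one   = no λ ()
two   ≟ᶜ two   = yes refl

step : Strategy → Strategy → GameState → GameState
step σ₁ σ₂ (state true  p c) = state false (c ∷ p) (apply one c (σ₁ p c))
step σ₁ σ₂ (state false p c) = state true  (c ∷ p) (apply two c (σ₂ p c))

run-suc : ∀ σ₁ σ₂ n → run σ₁ σ₂ (suc n) ≡ step σ₁ σ₂ (run σ₁ σ₂ n)
run-suc σ₁ σ₂ n with run σ₁ σ₂ n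
... | state true  p c = refl
... | state false p c = refl

positional : ((b : Board) → Move b) → Strategy
positional s _ b = s b

-- Definitionally  apply c b (mark i e)  for every e, but free of the proof e.
marked : Cell → Board → Fin 6 → Board
marked c b i j = if does (i Fin.≟ j) then c else b j

allMoves? : ∀ {ℓ} {Q : Board → Set ℓ} → Decidable Q →
  ∀ c b → Dec ((m : Move b) → Q (apply c b m))
allMoves? {Q = Q} Q? c b =
  map′ (λ { (q , _) pass → q ; (_ , q) (mark i e) → q i e })
       (λ q → q pass , λ i e → q (mark i e))
       (Q? b ×-dec all? λ i → (b i ≟ᶜ empty) →-dec Q? (marked c b i))

module Forcing {ℓ} {P : Board → Set ℓ} (P? : Decidable P) (s : (b : Board) → Move b) where

  data Forces : ℕ → Bool → Board → Set ℓ where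
    done      : ∀ {k t b} → P b → Forces k t b
    oneMoves  : ∀ {k b} → Forces k false (apply one b (s b)) → Forces (suc k) true b
    twoMoves  : ∀ {k b} → ((m : Move b) → Forces k true (apply two b m)) → Forces (suc k) false b

  forces? : ∀ k t b → Dec (Forces k t b)
  forces? zero t b = map′ done (λ { (done p) → p }) (P? b)
  forces? (suc k) true b =
    map′ [ done , oneMoves ]′ (λ { (done p) → inj₁ p ; (oneMoves f) → inj₂ f })
         (P? b ⊎-dec forces? k false (apply one b (s b)))
  forces? (suc k) false b =
    map′ [ done , twoMoves ]′ (λ { (done p) → inj₁ p ; (twoMoves f) → inj₂ f })
         (P? b ⊎-dec allMoves? (forces? k true) two b)

  forces⇒reached : ∀ σ₂ n {k t b p} → Forces k t b → run (positional s) σ₂ n ≡ state t p b →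
    Σ ℕ λ m → P (GameState.current (run (positional s) σ₂ m))
  forces⇒reached σ₂ n (done x) eq = n , subst P (cong GameState.current (sym eq)) x
  forces⇒reached σ₂ n (oneMoves f) eq =
    forces⇒reached σ₂ (suc n) f (trans (run-suc _ σ₂ n) (cong (step _ σ₂) eq))
  forces⇒reached σ₂ n {b = b} {p} (twoMoves f) eq =
    forces⇒reached σ₂ (suc n) (f (σ₂ p b)) (trans (run-suc _ σ₂ n) (cong (step _ σ₂) eq))

-- Cell i of the board is the number i + 1, so lowCell ranges over {1, 2, 3}, cellFour is 4 and
-- highCell ranges over {5, 6}.
lowCell : Fin 3 → Fin 6
lowCell = _↑ˡ 3

cellFour : Fin 6
cellFour = # 3

highCell : Fin 2 → Fin 6
highCell = 4 ↑ʳ_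

line : Fin 3 → Fin 2 → List ℕ
line x y = pos (lowCell x) ∷ pos cellFour ∷ pos (highCell y) ∷ []

levelOfLow : Fin 3 → Fin 3
levelOfLow zero    = # 0
levelOfLow (suc _) = # 1

levelOfLow≢2 : ∀ x → levelOfLow x ≢ # 2
levelOfLow≢2 zero    ()
levelOfLow≢2 (suc _) ()

lineLevels : Fin 3 → Fin 2 → Fin 3
lineLevels x zero       = levelOfLow x
lineLevels x (suc zero) = # 2

lineLevels-injective : ∀ x → Injective _≡_ _≡_ (lineLevels x)
lineLevels-injective x {zero}     {zero}     _  = refl
lineLevels-injective x {zero}     {suc zero} eq = ⊥-elim (levelOfLow≢2 x eq)
lineLevels-injective x {suc zero} {zero}     eq = ⊥-elim (levelOfLow≢2 x (sym eq))
lineLevels-injective x {suc zero} {suc zero} _  = refl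

LineShape : Fin 3 → Fin 2 → Set
LineShape x y =
  Linked _<_ (line x y) × line x y ⊆ B ×
  level (line x y) 0 ⊆ level B (toℕ (levelOfLow x)) × level (line x y) 1 ⊆ level B 2

lineShape : ∀ x y → LineShape x y
lineShape = from-yes (all? λ x → all? λ y →
  linked? _<?_ (line x y) ×-dec allᴸ? (_∈? B) (line x y) ×-dec
  allᴸ? (_∈? level B (toℕ (levelOfLow x))) (level (line x y) 0) ×-dec
  allᴸ? (_∈? level B 2) (level (line x y) 1))

line∈△₂B : ∀ x y → InTriOf 2 3 B (line x y)
line∈△₂B x y with lineShape x y
... | sorted , sub , low , high =
  (sorted , refl) , sub , lineLevels x , lineLevels-injective x ,
  λ { zero → low ; (suc zero) → high }

OwnsLine : Board → Set
OwnsLine b = ∃₂ λ x y → b (lowCell x) ≡ one × b cellFour ≡ one × b (highCell y) ≡ one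

ownsLine? : Decidable OwnsLine
ownsLine? b = any? λ x → any? λ y →
  (b (lowCell x) ≟ᶜ one) ×-dec (b cellFour ≟ᶜ one) ×-dec (b (highCell y) ≟ᶜ one)

ownsLine⇒OneWins : ∀ {b} → OwnsLine b → OneWins b
ownsLine⇒OneWins (x , y , o₁ , o₂ , o₃) =
  line x y , line∈△₂B x y , (_ , refl , o₁) ∷ (_ , refl , o₂) ∷ (_ , refl , o₃) ∷ []

firstEmpty : List (Fin 6) → (b : Board) → Move b
firstEmpty []       b = pass
firstEmpty (i ∷ is) b with b i ≟ᶜ empty
... | yes e = mark i e
... | no  _ = firstEmpty is b

owned : Board → List (Fin 6) → ℕ
owned b is = length (filter (λ i → b i ≟ᶜ one) is)

lowerLevels topLevel : List (Fin 6)
lowerLevels = # 0 ∷ # 1 ∷ # 2 ∷ []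
topLevel    = # 3 ∷ # 4 ∷ # 5 ∷ []

strategy : (b : Board) → Move b
strategy b = if 2 ≤ᵇ owned b topLevel then firstEmpty lowerLevels b else firstEmpty topLevel b

open Forcing ownsLine? strategy

strategy-forces : Forces 5 true initial
strategy-forces = from-yes (forces? 5 true initial)

theorem4 : Σ Strategy λ σ₁ → (σ₂ : Strategy) →
    Σ ℕ λ n → OneWins (GameState.current (run σ₁ σ₂ n))
theorem4 = positional strategy , λ σ₂ →
  map₂ ownsLine⇒OneWins (forces⇒reached σ₂ 0 strategy-forces refl)
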